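{- Let $w\in S_n$ and $I\subseteq J(w)$. If $w$ is $I$-spherical, then $w$ is proper, i.e. $\ell(w)-\binom{d(w)+1}{2}\le n$.
   Context: For $w\in S_n$, $\ell(w)=\#\{i<j: w(i)>w(j)\}$, $J(w)=\{i\in[n-1]: w^{ -1}(i+1)<w^{ -1}(i)\}$, $d(w)=\#J(w)$. Let $s_i=(i\ i+1)$; an expression $w=s_{i_1}\cdots s_{i_\ell}$ is reduced if $\ell=\ell(w)$. For $I\subseteq J(w)$ write $[n-1]\setminus I=\{d_1<\cdots<d_k\}$, $d_0=0$, $d_{k+1}=n$. Then $w$ is $I$-spherical if there is a reduced expression $s_{i_1}\cdots s_{i_{\ell(w)}}$ for $w$ such that (I) each $s_{d_i}$, $1\le i\le k$, appears at most once in it, and (II) $\#\{m: d_{t-1}<i_m<d_t\}\le\binom{d_t-d_{t-1}+1}{2}-1$ for each $1\le t\le k+1$. -}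

module Defs where

open import Data.Nat using (ℕ; zero; suc; _+_; _∸_; _≤_; _<_; _<ᵇ_; _≡ᵇ_)
open import Data.Nat.Properties using (_<?_)
open import Data.Nat.Combinatorics using (_C_)
open import Data.Bool using (Bool; true; false; if_then_else_; _∧_; not)
open import Data.List using (List; []; _∷_; length; filterᵇ; map; upTo; concatMap; _++_)
open import Data.List.Relation.Unary.All using (All)
open import Data.Bool.ListAction using (any)
open import Data.Fin using (Fin; toℕ; fromℕ<)
open import Data.Fin.Permutation using (Permutation′; _⟨$⟩ʳ_; _⟨$⟩ˡ_)
open import Data.Product using (_×_; _,_; Σ)
open import Relation.Binary.PropositionalEquality using (_≡_)
open import Relation.Nullary using (yes; no)

-- Conventions: values/positions of a permutation are written 1-based
-- (as in the paper, [n] = {1,…,n}); a permutation w ∈ S_n is a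
-- Permutation′ n acting on Fin n (0-based), converted below.

countᵇ : {A : Set} → (A → Bool) → List A → ℕ
countᵇ p xs = length (filterᵇ p xs)

oneTo : ℕ → List ℕ
oneTo k = map suc (upTo k)

-- 1-based action of w and of w⁻¹ on ℕ (value 0 outside [n], never used there)
app : {n : ℕ} → Permutation′ n → ℕ → ℕ
app {n} w zero = 0
app {n} w (suc k) with k <? n
... | yes p = suc (toℕ (w ⟨$⟩ʳ fromℕ< p))
... | no _  = 0

appInv : {n : ℕ} → Permutation′ n → ℕ → ℕ
appInv {n} w zero = 0
appInv {n} w (suc k) with k <? n
... | yes p = suc (toℕ (w ⟨$⟩ˡ fromℕ< p))
... | no _  = 0

len : {n : ℕ} → Permutation′ n → ℕ
len {n} w = countᵇ (λ ij → (Data.Product.proj₁ ij <ᵇ Data.Product.proj₂ ij)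
                         ∧ (app w (Data.Product.proj₂ ij) <ᵇ app w (Data.Product.proj₁ ij)))
                   (concatMap (λ i → map (λ j → (i , j)) (oneTo n)) (oneTo n))

isDescᵇ : {n : ℕ} → Permutation′ n → ℕ → Bool
isDescᵇ w i = appInv w (suc i) <ᵇ appInv w i

InJ : {n : ℕ} → Permutation′ n → ℕ → Set
InJ {n} w i = (1 ≤ i) × (i < n) × (appInv w (suc i) < appInv w i)

des : {n : ℕ} → Permutation′ n → ℕ
des {n} w = countᵇ (isDescᵇ w) (oneTo (n ∸ 1))

sAct : ℕ → ℕ → ℕ
sAct i m = if m ≡ᵇ i then suc i else (if m ≡ᵇ suc i then i else m)

wordAct : List ℕ → ℕ → ℕ
wordAct [] m = m
wordAct (i ∷ is) m = sAct i (wordAct is m)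

IsExpression : {n : ℕ} → Permutation′ n → List ℕ → Set
IsExpression {n} w word =
  All (λ i → (1 ≤ i) × (i < n)) word ×
  ((x : Fin n) → suc (toℕ (w ⟨$⟩ʳ x)) ≡ wordAct word (suc (toℕ x)))

IsReducedExpression : {n : ℕ} → Permutation′ n → List ℕ → Set
IsReducedExpression w word = IsExpression w word × (length word ≡ len w)

memᵇ : ℕ → List ℕ → Bool
memᵇ i I = any (λ j → i ≡ᵇ j) I

complementList : ℕ → List ℕ → List ℕ
complementList n I = filterᵇ (λ i → not (memᵇ i I)) (oneTo (n ∸ 1))

boundaries : ℕ → List ℕ → List ℕ
boundaries n I = 0 ∷ (complementList n I ++ (n ∷ []))

consecutive : List ℕ → List (ℕ × ℕ)
consecutive (x ∷ y ∷ xs) = (x , y) ∷ consecutive (y ∷ xs)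
consecutive _ = []

ISpherical : {n : ℕ} → Permutation′ n → List ℕ → Set
ISpherical {n} w I =
  Σ (List ℕ) λ word →
    IsReducedExpression w word ×
    All (λ d → countᵇ (λ j → j ≡ᵇ d) word ≤ 1) (complementList n I) ×
    All (λ p → countᵇ (λ j → (Data.Product.proj₁ p <ᵇ j) ∧ (j <ᵇ Data.Product.proj₂ p)) word + 1
                 ≤ (Data.Product.proj₂ p ∸ Data.Product.proj₁ p + 1) C 2)
        (consecutive (boundaries n I))

-- Every letter of a reduced word is either some d_t, which occurs at most
-- once, or lies strictly inside a block (d_{t-1}, d_t), which by (II)
-- holds at most C(d_t − d_{t-1} + 1, 2) − 1 letters. Since C(x+1, 2) is
-- convex, the total block bound is largest when all k+1 blocks but one
-- have width 1, giving ℓ(w) ≤ k + C(e+2, 2) − 1 = n − 1 + C(e+1, 2)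
-- with e = n − 1 − k.
-- Finally [n−1] ⊆ ([n−1] ∖ I) ∪ J(w) because I ⊆ J(w), so e ≤ d(w).
module Submission where

open import Defs
open import Data.Nat using (ℕ; zero; suc; _+_; _∸_; _≤_; _<_; _<ᵇ_; _≡ᵇ_; z≤n; s≤s)
open import Data.Nat.Properties
open import Data.Nat.Combinatorics using (_C_; nC1≡n; nCk+nC[k+1]≡[n+1]C[k+1])
open import Data.Nat.ListAction using (sum)
open import Data.Nat.ListAction.Properties using (sum-++)
open import Data.Nat.Tactic.RingSolver using (solve-∀)
open import Data.Bool using (Bool; true; false; T; _∧_; not)
open import Data.Bool.Properties using (T-∧)
open import Data.Unit using (tt)
open import Data.List using (List; []; _∷_; _++_; _∷ʳ_; length; filterᵇ; map; upTo)
open import Data.List.Properties using (length-map; length-upTo; map-upTo; applyUpTo-∷ʳ; map-++; map-∘)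
open import Data.List.Relation.Unary.All using (All; []; _∷_; lookupAny)
import Data.List.Relation.Unary.All as All
open import Data.List.Relation.Unary.Any using (Any; here; there)
import Data.List.Relation.Unary.Any as Any
open import Data.List.Relation.Unary.Any.Properties using (any⁻; map⁺; ++⁺ˡ; ++⁺ʳ)
open import Data.List.Relation.Unary.Linked using (Linked; [-]; _∷_)
open import Data.List.Relation.Unary.Linked.Properties using (applyUpTo⁺₂)
open import Data.Fin.Permutation using (Permutation′)
open import Data.Product using (_×_; _,_; proj₁; proj₂; ∃-syntax)
open import Data.Sum using (_⊎_; inj₁; inj₂; [_,_]′) renaming (map to map-⊎)
open import Function using (_∘_; Equivalence)
open import Relation.Binary using (Transitive; tri<; tri≈; tri>)
open import Relation.Binary.PropositionalEquality

C2-suc : ∀ m → suc m C 2 ≡ m + m C 2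
C2-suc m = begin
  suc m C 2       ≡⟨ nCk+nC[k+1]≡[n+1]C[k+1] m 1 ⟨
  m C 1 + m C 2   ≡⟨ cong (_+ m C 2) (nC1≡n m) ⟩
  m + m C 2       ∎
  where open ≡-Reasoning

C2-mono-≤ : ∀ {m n} → m ≤ n → m C 2 ≤ n C 2
C2-mono-≤ z≤n = z≤n
C2-mono-≤ {suc m} {suc n} (s≤s m≤n) = begin
  suc m C 2   ≡⟨ C2-suc m ⟩
  m + m C 2   ≤⟨ +-mono-≤ m≤n (C2-mono-≤ m≤n) ⟩
  n + n C 2   ≡⟨ C2-suc n ⟨
  suc n C 2   ∎
  where open ≤-Reasoning

[2+m]C2+[2+n]C2≤[2+m+n]C2+1 : ∀ m n → suc (suc m) C 2 + suc (suc n) C 2 ≤ suc (suc (m + n)) C 2 + 1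
[2+m]C2+[2+n]C2≤[2+m+n]C2+1 zero n = ≤-reflexive (+-comm 1 (suc (suc n) C 2))
[2+m]C2+[2+n]C2≤[2+m+n]C2+1 (suc m) n = begin
  suc (suc (suc m)) C 2 + suc (suc n) C 2
    ≡⟨ cong (_+ suc (suc n) C 2) (C2-suc (suc (suc m))) ⟩
  suc (suc m) + suc (suc m) C 2 + suc (suc n) C 2
    ≡⟨ +-assoc (suc (suc m)) _ _ ⟩
  suc (suc m) + (suc (suc m) C 2 + suc (suc n) C 2)
    ≤⟨ +-mono-≤ (s≤s (s≤s (m≤m+n m n))) ([2+m]C2+[2+n]C2≤[2+m+n]C2+1 m n) ⟩
  suc (suc (m + n)) + (suc (suc (m + n)) C 2 + 1)
    ≡⟨ +-assoc (suc (suc (m + n))) _ 1 ⟨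
  suc (suc (m + n)) + suc (suc (m + n)) C 2 + 1
    ≡⟨ cong (_+ 1) (C2-suc (suc (suc (m + n)))) ⟨
  suc (suc (suc m + n)) C 2 + 1 ∎
  where open ≤-Reasoning

countᵇ-≤-∷ : ∀ {A : Set} (p : A → Bool) x xs → countᵇ p xs ≤ countᵇ p (x ∷ xs)
countᵇ-≤-∷ p x xs with p x
... | true  = n≤1+n _
... | false = ≤-refl

countᵇ-<-∷ : ∀ {A : Set} (p : A → Bool) {x} xs → T (p x) → countᵇ p xs < countᵇ p (x ∷ xs)
countᵇ-<-∷ p {x} xs px with p x
... | true = ≤-refl

sum-map-mono-≤ : ∀ {A : Set} {f g : A → ℕ} {xs} → All (λ x → f x ≤ g x) xs →
                 sum (map f xs) ≤ sum (map g xs)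
sum-map-mono-≤ []          = z≤n
sum-map-mono-≤ (fx≤gx ∷ h) = +-mono-≤ fx≤gx (sum-map-mono-≤ h)

sum-map-mono-< : ∀ {A : Set} {f g : A → ℕ} {xs} → (∀ x → f x ≤ g x) →
                 Any (λ x → f x < g x) xs → sum (map f xs) < sum (map g xs)
sum-map-mono-< {xs = x ∷ xs} f≤g (here fx<gx) =
  +-mono-<-≤ fx<gx (sum-map-mono-≤ {xs = xs} (All.tabulate (λ {y} _ → f≤g y)))
sum-map-mono-< {xs = x ∷ xs} f≤g (there h) =
  +-mono-≤-< (f≤g x) (sum-map-mono-< f≤g h)

sum-map-≤-length : ∀ {A : Set} {f : A → ℕ} {xs} → All (λ x → f x ≤ 1) xs → sum (map f xs) ≤ length xs
sum-map-≤-length []         = z≤n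
sum-map-≤-length (fx≤1 ∷ h) = +-mono-≤ fx≤1 (sum-map-≤-length h)

length≤sum-countᵇ : ∀ {A : Set} (ps : List (A → Bool)) (xs : List A) →
                    All (λ x → Any (λ p → T (p x)) ps) xs →
                    length xs ≤ sum (map (λ p → countᵇ p xs) ps)
length≤sum-countᵇ ps []       []         = z≤n
length≤sum-countᵇ ps (x ∷ xs) (hit ∷ hits) =
  ≤-trans (s≤s (length≤sum-countᵇ ps xs hits))
          (sum-map-mono-< (λ p → countᵇ-≤-∷ p x xs) (Any.map (countᵇ-<-∷ _ xs) hit))

∷-filterᵇ-∷ʳ⁺ : ∀ {A : Set} {R : A → A → Set} → Transitive R → (p : A → Bool) →
                ∀ a xs b → Linked R (a ∷ xs ∷ʳ b) → Linked R (a ∷ filterᵇ p xs ∷ʳ b)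
∷-filterᵇ-∷ʳ⁺ trans p a []       b rs = rs
∷-filterᵇ-∷ʳ⁺ {R = R} trans p a (y ∷ ys) b (r ∷ rs) with p y
... | true  = r ∷ ∷-filterᵇ-∷ʳ⁺ trans p y ys b rs
... | false = ∷-filterᵇ-∷ʳ⁺ trans p a ys b (weaken r rs)
  where
  weaken : ∀ {a y zs} → R a y → Linked R (y ∷ zs) → Linked R (a ∷ zs)
  weaken r [-]       = [-]
  weaken r (r′ ∷ rs) = trans r r′ ∷ rs

boundaries-increasing : ∀ n I → Linked _<_ (boundaries (suc n) I)
boundaries-increasing n I =
  ∷-filterᵇ-∷ʳ⁺ <-trans (λ i → not (memᵇ i I)) 0 (oneTo n) (suc n) 0∷oneTo∷ʳ
  where
  0∷oneTo∷ʳ : Linked _<_ (0 ∷ oneTo n ∷ʳ suc n)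
  0∷oneTo∷ʳ = subst (λ xs → Linked _<_ (0 ∷ xs))
                (trans (sym (applyUpTo-∷ʳ suc n)) (cong (_∷ʳ suc n) (sym (map-upTo suc n))))
                (applyUpTo⁺₂ (λ i → i) (suc (suc n)) n<1+n)

between : ℕ × ℕ → ℕ → Bool
between q j = (proj₁ q <ᵇ j) ∧ (j <ᵇ proj₂ q)

∈-or-between : ∀ a xs b {j} → a < j → j < b →
               Any (λ y → T (j ≡ᵇ y)) xs ⊎ Any (λ q → T (between q j)) (consecutive (a ∷ xs ∷ʳ b))
∈-or-between a []       b a<j j<b = inj₂ (here (Equivalence.from T-∧ (<⇒<ᵇ a<j , <⇒<ᵇ j<b)))
∈-or-between a (y ∷ ys) b {j} a<j j<b with <-cmp j y
... | tri< j<y _ _ = inj₂ (here (Equivalence.from T-∧ (<⇒<ᵇ a<j , <⇒<ᵇ j<y)))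
... | tri≈ _ j≡y _ = inj₁ (here (≡⇒≡ᵇ j y j≡y))
... | tri> _ _ y<j = map-⊎ there there (∈-or-between y ys b y<j j<b)

spanC2 : ℕ × ℕ → ℕ
spanC2 q = (proj₂ q ∸ proj₁ q + 1) C 2

spanC2-suc : ∀ a g → spanC2 (a , suc a + g) ≡ suc (suc g) C 2
spanC2-suc a g = begin
  (suc a + g ∸ a + 1) C 2   ≡⟨ cong (λ x → (x ∸ a + 1) C 2) (+-suc a g) ⟨
  (a + suc g ∸ a + 1) C 2   ≡⟨ cong (λ x → (x + 1) C 2) (m+n∸m≡n a (suc g)) ⟩
  (suc g + 1) C 2           ≡⟨ cong (_C 2) (+-comm (suc g) 1) ⟩
  suc (suc g) C 2           ∎
  where open ≡-Reasoning

-- By convexity of C(·, 2) the weights are bounded as if all gaps but one had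
-- width 1; e is the excess of b − a over the number of gaps.
sum-gaps+1≤C2 : (f : ℕ × ℕ → ℕ) → ∀ a xs b → Linked _<_ (a ∷ xs ∷ʳ b) →
                All (λ q → f q + 1 ≤ spanC2 q) (consecutive (a ∷ xs ∷ʳ b)) →
                ∃[ e ] b ≡ a + suc (length xs) + e ×
                       sum (map f (consecutive (a ∷ xs ∷ʳ b))) + 1 ≤ suc (suc e) C 2
sum-gaps+1≤C2 f a [] b (a<b ∷ [-]) (fq+1≤ ∷ []) with m≤n⇒∃[o]m+o≡n a<b
... | g , refl = g , cong (_+ g) (+-comm 1 a) , (begin
  f (a , suc a + g) + 0 + 1   ≡⟨ cong (_+ 1) (+-identityʳ _) ⟩
  f (a , suc a + g) + 1       ≤⟨ fq+1≤ ⟩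
  spanC2 (a , suc a + g)      ≡⟨ spanC2-suc a g ⟩
  suc (suc g) C 2             ∎)
  where open ≤-Reasoning
sum-gaps+1≤C2 f a (y ∷ ys) b (a<y ∷ rs) (fq+1≤ ∷ hs) with m≤n⇒∃[o]m+o≡n a<y
... | g , refl with sum-gaps+1≤C2 f (suc a + g) ys b rs hs
...   | e , b≡ , rest+1≤ = g + e , trans b≡ (regroup a g (length ys) e) , +-cancelʳ-≤ 1 _ _ (begin
  fq + rest + 1 + 1           ≡⟨ regroup′ fq rest ⟩
  (fq + 1) + (rest + 1)       ≤⟨ +-mono-≤ (≤-trans fq+1≤ (≤-reflexive (spanC2-suc a g))) rest+1≤ ⟩
  suc (suc g) C 2 + suc (suc e) C 2
                              ≤⟨ [2+m]C2+[2+n]C2≤[2+m+n]C2+1 g e ⟩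
  suc (suc (g + e)) C 2 + 1   ∎)
  where
  open ≤-Reasoning
  fq rest : ℕ
  fq = f (a , suc a + g)
  rest = sum (map f (consecutive (suc a + g ∷ ys ∷ʳ b)))
  regroup : ∀ a g l e → suc a + g + suc l + e ≡ a + suc (suc l) + (g + e)
  regroup = solve-∀
  regroup′ : ∀ x y → x + y + 1 + 1 ≡ (x + 1) + (y + 1)
  regroup′ = solve-∀

length≤letter-counts : ∀ n D word → All (λ i → 1 ≤ i × i < n) word →
  length word ≤ sum (map (λ d → countᵇ (λ j → j ≡ᵇ d) word) D)
              + sum (map (λ q → countᵇ (between q) word) (consecutive (0 ∷ D ∷ʳ n)))
length≤letter-counts n D word letters = begin
  length word                                           ≤⟨ length≤sum-countᵇ (tests ++ gaps) word covered ⟩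
  sum (map count (tests ++ gaps))                       ≡⟨ cong sum (map-++ count tests gaps) ⟩
  sum (map count tests ++ map count gaps)               ≡⟨ sum-++ (map count tests) (map count gaps) ⟩
  sum (map count tests) + sum (map count gaps)          ≡⟨ cong₂ _+_ (cong sum (map-∘ D)) (cong sum (map-∘ P)) ⟨
  sum (map (count ∘ (λ d j → j ≡ᵇ d)) D) + sum (map (count ∘ between) P) ∎
  where
  open ≤-Reasoning
  P : List (ℕ × ℕ)
  P = consecutive (0 ∷ D ∷ʳ n)
  tests gaps : List (ℕ → Bool)
  tests = map (λ d j → j ≡ᵇ d) D
  gaps = map between P
  count : (ℕ → Bool) → ℕ
  count p = countᵇ p word
  covered : All (λ j → Any (λ p → T (p j)) (tests ++ gaps)) word
  covered = All.map (λ (0<j , j<n) → [ ++⁺ˡ ∘ map⁺ , ++⁺ʳ tests ∘ map⁺ ]′ (∈-or-between 0 D n 0<j j<n))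
                    letters

∉-or-descent : ∀ {n} (w : Permutation′ n) I → All (InJ w) I →
               ∀ i → T (not (memᵇ i I)) ⊎ T (isDescᵇ w i)
∉-or-descent w I I⊆J i with memᵇ i I in i∈I
... | false = inj₁ tt
... | true with lookupAny I⊆J (any⁻ (i ≡ᵇ_) I (subst T (sym i∈I) tt))
...   | (_ , _ , descent) , i≡ᵇj = inj₂ (subst (T ∘ isDescᵇ w) (sym (≡ᵇ⇒≡ i _ i≡ᵇj)) (<⇒<ᵇ descent))

n∸1≤length-complementList+des : ∀ {n} (w : Permutation′ n) I → All (InJ w) I →
                                 n ∸ 1 ≤ length (complementList n I) + des w
n∸1≤length-complementList+des {n} w I I⊆J = begin
  n ∸ 1                                              ≡⟨ length-oneTo (n ∸ 1) ⟨
  length (oneTo (n ∸ 1))                             ≤⟨ length≤sum-countᵇ (notIn ∷ isDescᵇ w ∷ []) (oneTo (n ∸ 1)) covered ⟩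
  length (complementList n I) + (des w + 0)          ≡⟨ cong (length (complementList n I) +_) (+-identityʳ (des w)) ⟩
  length (complementList n I) + des w                ∎
  where
  open ≤-Reasoning
  notIn : ℕ → Bool
  notIn i = not (memᵇ i I)
  length-oneTo : ∀ m → length (oneTo m) ≡ m
  length-oneTo m = trans (length-map suc (upTo m)) (length-upTo m)
  covered : All (λ i → Any (λ p → T (p i)) (notIn ∷ isDescᵇ w ∷ [])) (oneTo (n ∸ 1))
  covered = All.tabulate (λ {i} _ → [ here , there ∘ here ]′ (∉-or-descent w I I⊆J i))

proposition3p3 : (n : ℕ) (w : Permutation′ n) (I : List ℕ) →
    All (InJ w) I → ISpherical w I →
    len w ≤ n + (suc (des w) C 2)
proposition3p3 zero    w I I⊆J _ = z≤n
proposition3p3 (suc n) w I I⊆J (word , (expression , length≡len) , onceEach , gapBounds)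
  with sum-gaps+1≤C2 (λ q → countᵇ (between q) word) 0 (complementList (suc n) I) (suc n)
                     (boundaries-increasing n I) gapBounds
... | e , n≡k+e , inner+1≤ = begin
  len w                         ≡⟨ length≡len ⟨
  length word                   ≤⟨ length≤letter-counts (suc n) D word (proj₁ expression) ⟩
  outer + inners                ≤⟨ +-monoˡ-≤ inners (sum-map-≤-length onceEach) ⟩
  k + inners                    ≤⟨ +-monoʳ-≤ k inners≤ ⟩
  k + (e + suc e C 2)           ≡⟨ +-assoc k e _ ⟨
  k + e + suc e C 2             ≤⟨ +-monoˡ-≤ _ (n≤1+n (k + e)) ⟩
  suc (k + e) + suc e C 2       ≡⟨ cong (_+ suc e C 2) n≡k+e ⟨
  suc n + suc e C 2             ≤⟨ +-monoʳ-≤ (suc n) (C2-mono-≤ (s≤s e≤des)) ⟩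
  suc n + suc (des w) C 2       ∎
  where
  open ≤-Reasoning
  D : List ℕ
  D = complementList (suc n) I
  k outer inners : ℕ
  k = length D
  outer = sum (map (λ d → countᵇ (λ j → j ≡ᵇ d) word) D)
  inners = sum (map (λ q → countᵇ (between q) word) (consecutive (boundaries (suc n) I)))
  inners≤ : inners ≤ e + suc e C 2
  inners≤ = ≤-pred (subst (_≤ suc e + suc e C 2) (+-comm inners 1)
              (≤-trans inner+1≤ (≤-reflexive (C2-suc (suc e)))))
  e≤des : e ≤ des w
  e≤des = +-cancelˡ-≤ k e (des w)
            (subst (_≤ k + des w) (suc-injective n≡k+e) (n∸1≤length-complementList+des w I I⊆J))
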